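{- Let $p$ be a prime. Let $N_p$ denote the set $\mathbb{N}=\{0,1,2,\dots\}$ equipped with the $p$-adic metric $d_p(m,n)=p^{ -v(m-n)}$ (with $d_p(m,m)=0$), where $v(k)$ is the largest power of $p$ dividing $k$. For an integer $n$, let $[n]_p\in\{0,\dots,p-1\}$ be the residue of $n$ modulo $p$ and let $k_p(n)$ be the unique integer with $n=k_p(n)p+[n]_p$. Define \[A: N_p\times N_p\to \tfrac{1}{p}(N_p\times N_p)\times V_p,\qquad A(m,n)=\bigl(k_p(m)+k_p([m]_p+[n]_p),\ k_p(n),\ [m+n]_p\bigr).\] Then $A$ is a nonexpanding map, i.e. $d(A(x),A(y))\le d(x,y)$ for all $x,y\in N_p\times N_p$.
   Context: All metric spaces are $1$-bounded. Products of metric spaces carry the maximum metric. For a metric space $X$ with metric $d$, $\tfrac{1}{p}X$ denotes the same set with metric $\tfrac{1}{p}d$. $V_p$ denotes the set $\{0,1,\dots,p-1\}$ with the discrete metric (distance $1$ between distinct points). A map $f:X\to Y$ is nonexpanding if $d_Y(f(x),f(y))\le d_X(x,y)$ for all $x,y$. -}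

module Defs where

open import Data.Nat as ℕ using (ℕ; zero; suc; _+_; _^_; NonZero; ∣_-_∣; _/_; _%_)
open import Data.Nat.Properties using (m^n≢0)
open import Data.Nat.Divisibility using (_∣?_)
open import Data.Integer using (+_)
open import Data.Rational as ℚ using (ℚ; 0ℚ; 1ℚ; _⊔_; _≤_)
open import Data.Product using (_×_; _,_)
open import Relation.Nullary using (yes; no)

-- Computed by repeatedly dividing by p; the fuel argument is at least k,
-- which suffices since p^e ≤ k whenever p^e ∣ k, k ≠ 0 and p ≥ 2.
valAux : (p : ℕ) → .{{NonZero p}} → ℕ → ℕ → ℕ
valAux p zero    k = 0
valAux p (suc f) zero = 0
valAux p (suc f) (suc k) with p ∣? suc k
... | yes _ = suc (valAux p f (suc k / p))
... | no  _ = 0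

val : (p : ℕ) → .{{NonZero p}} → ℕ → ℕ
val p k = valAux p k k

dp : (p : ℕ) → .{{_ : NonZero p}} → ℕ → ℕ → ℚ
dp p m n with m ℕ.≟ n
... | yes _ = 0ℚ
... | no  _ = ℚ._/_ (+ 1) (p ^ val p ∣ m - n ∣) {{m^n≢0 p (val p ∣ m - n ∣)}}

-- discrete metric on V_p = {0,…,p-1}
dV : ℕ → ℕ → ℚ
dV a b with a ℕ.≟ b
... | yes _ = 0ℚ
... | no  _ = 1ℚ

dNN : (p : ℕ) → .{{_ : NonZero p}} → ℕ × ℕ → ℕ × ℕ → ℚ
dNN p (m , n) (m' , n') = dp p m m' ⊔ dp p n n'

-- metric on (1/p)(N_p × N_p) × V_p (max metric)
dTarget : (p : ℕ) → .{{_ : NonZero p}} → (ℕ × ℕ) × ℕ → (ℕ × ℕ) × ℕ → ℚ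
dTarget p (x , a) (y , b) = (ℚ._/_ (+ 1) p ℚ.* dNN p x y) ⊔ dV a b

-- [n]_p = n % p  and  k_p(n) = n / p
A : (p : ℕ) → .{{_ : NonZero p}} → ℕ × ℕ → (ℕ × ℕ) × ℕ
A p (m , n) = ((m / p + (m % p + n % p) / p , n / p) , (m + n) % p)

Nonexpanding : (p : ℕ) → .{{_ : NonZero p}} → (ℕ × ℕ → (ℕ × ℕ) × ℕ) → Set
Nonexpanding p f = ∀ x y → dTarget p (f x) (f y) ≤ dNN p x y

module Submission where

-- Write D = max(d_p(m,m'), d_p(n,n')) for the distance of the two inputs.
--  * If m ≢ m' or n ≢ n' modulo p, then p ∤ m - m' (resp. n - n'), so the
--    valuation is 0 and D = 1; every point of the target is within 1 of every
--    other point, so the inequality holds.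
--  * If m ≡ m' and n ≡ n' modulo p, the carries ⌊([m]+[n])/p⌋ agree, the
--    residues [m+n] agree (so the V_p-distance is 0), and each remaining
--    coordinate difference c satisfies p·|c| = |x - x'| for the corresponding
--    input difference.  Since v(p·c) ≤ 1 + v(c), the scaled distance
--    (1/p)·p^{-v(c)} is at most p^{-v(x-x')}.

open import Defs
open import Data.Nat.Primality using (Prime)
open import Data.Nat as ℕ using (ℕ; NonZero; zero; suc; _+_; _*_; _∸_; _^_; _/_; _%_; ∣_-_∣; _<_; z≤n; s≤s)
open import Data.Nat.Properties as ℕP using (m^n≢0)
open import Data.Nat.Divisibility using (_∣_; _∣?_; ∣⇒≤; *-cancelˡ-∣; *-monoʳ-∣; ∣-trans; m∣m*n; 1∣_; _∣0)
open import Data.Nat.DivMod using (m*[n/m]≡n; m/n<m; m≥n⇒m/n>0; m≡m%n+[m/n]*n; %-remove-+ʳ; %-distribˡ-+)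
open import Data.Nat.GCD using (gcd-zeroˡ)
open import Data.Integer as ℤ using (+_)
import Data.Integer.Properties as ℤP
open import Data.Integer.GCD using () renaming (gcd to ℤgcd)
open import Data.Rational as ℚ using (ℚ; 0ℚ; 1ℚ; ↥_; ↧_; mkℚ; _⊔_)
import Data.Rational.Properties as ℚP
open import Data.Product using (_×_; _,_)
open import Data.Sum using (inj₁; inj₂)
open import Relation.Nullary using (¬_; yes; no; contradiction)
open import Relation.Binary.PropositionalEquality

module Valuation (p : ℕ) .{{_ : NonZero p}} (1<p : 1 < p) where

  valAux-divides : ∀ fuel k → p ^ valAux p fuel k ∣ k
  valAux-divides zero    k       = 1∣ k
  valAux-divides (suc f) zero    = 1∣ 0
  valAux-divides (suc f) (suc k) with p ∣? suc k
  ... | yes p∣k = subst (p * p ^ valAux p f (suc k / p) ∣_) (m*[n/m]≡n p∣k)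
                        (*-monoʳ-∣ p (valAux-divides f (suc k / p)))
  ... | no  _   = 1∣ _

  valAux-maximal : ∀ fuel k e → k ℕ.≤ fuel → 0 < k → p ^ e ∣ k → e ℕ.≤ valAux p fuel k
  valAux-maximal fuel    k       zero    _ _  _ = z≤n
  valAux-maximal (suc f) (suc k) (suc e) k≤fuel _ pᵉ⁺¹∣k with p ∣? suc k
  ... | no  p∤k = contradiction (∣-trans (m∣m*n (p ^ e)) pᵉ⁺¹∣k) p∤k
  ... | yes p∣k = s≤s (valAux-maximal f q e q≤f (m≥n⇒m/n>0 (∣⇒≤ p∣k)) pᵉ∣q)
    where
    q = suc k / p
    q≤f : q ℕ.≤ f
    q≤f = ℕP.≤-pred (ℕP.≤-trans (m/n<m (suc k) p 1<p) k≤fuel)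
    pᵉ∣q : p ^ e ∣ q
    pᵉ∣q = *-cancelˡ-∣ p (subst (p * p ^ e ∣_) (sym (m*[n/m]≡n p∣k)) pᵉ⁺¹∣k)

  val-p* : ∀ k → 0 < k → val p (p * k) ℕ.≤ suc (val p k)
  val-p* k 0<k = bound (val p (p * k)) (valAux-divides (p * k) (p * k))
    where
    bound : ∀ e → p ^ e ∣ p * k → e ℕ.≤ suc (val p k)
    bound zero    _ = z≤n
    bound (suc e) pᵉ⁺¹∣pk = s≤s (valAux-maximal k k e ℕP.≤-refl 0<k (*-cancelˡ-∣ p pᵉ⁺¹∣pk))

  val-indivisible : ∀ k → ¬ (p ∣ k) → val p k ≡ 0
  val-indivisible zero    p∤k = refl
  val-indivisible (suc k) p∤k with p ∣? suc k
  ... | yes p∣k = contradiction p∣k p∤k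
  ... | no  _   = refl

IsUnitFraction : ℚ → ℕ → Set
IsUnitFraction x n = ↥ x ≡ + 1 × ↧ x ≡ + n

1/n-isUnitFraction : ∀ n .{{_ : NonZero n}} → IsUnitFraction (+ 1 ℚ./ n) n
1/n-isUnitFraction n = reduced (ℚP.↥-/ (+ 1) n) , reduced (ℚP.↧-/ (+ 1) n)
  where
  gcd[1,n]≡1 : ℤgcd (+ 1) (+ n) ≡ + 1
  gcd[1,n]≡1 = cong +_ (gcd-zeroˡ n)
  reduced : ∀ {i j} → i ℤ.* ℤgcd (+ 1) (+ n) ≡ j → i ≡ j
  reduced {i} eq = trans (sym (ℤP.*-identityʳ i)) (trans (cong (i ℤ.*_) (sym gcd[1,n]≡1)) eq)

*-isUnitFraction : ∀ x y {a b} → IsUnitFraction x a → IsUnitFraction y b → IsUnitFraction (x ℚ.* y) (a * b)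
*-isUnitFraction (mkℚ _ a-1 _) (mkℚ _ b-1 _) (refl , refl) (refl , refl) =
  1/n-isUnitFraction (suc a-1 * suc b-1)

unitFraction-antitone : ∀ {x y a b} → IsUnitFraction x a → IsUnitFraction y b → b ℕ.≤ a → x ℚ.≤ y
unitFraction-antitone {x} {y} {a} {b} (↥x , ↧x) (↥y , ↧y) b≤a =
  ℚ.*≤* (subst₂ ℤ._≤_ (sym (cross ↥x ↧y)) (sym (cross ↥y ↧x)) (ℤ.+≤+ b≤a))
  where
  cross : ∀ {i j n} → i ≡ + 1 → j ≡ + n → i ℤ.* j ≡ + n
  cross {n = n} refl refl = ℤP.*-identityˡ (+ n)

1/n-nonNeg : ∀ n .{{_ : NonZero n}} → 0ℚ ℚ.≤ + 1 ℚ./ n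
1/n-nonNeg n = ℚP.nonNegative⁻¹ _ {{ℚP.normalize-nonNeg 1 n}}

0≤1 : 0ℚ ℚ.≤ 1ℚ
0≤1 = 1/n-nonNeg 1

module Metric (p : ℕ) .{{_ : NonZero p}} (1<p : 1 < p) where

  open Valuation p 1<p

  p⁻¹ : ℚ
  p⁻¹ = + 1 ℚ./ p

  instance
    p⁻¹-nonNeg : ℚ.NonNegative p⁻¹
    p⁻¹-nonNeg = ℚP.normalize-nonNeg 1 p

  p^-_ : ℕ → ℚ
  p^- e = (+ 1 ℚ./ p ^ e) {{m^n≢0 p e}}

  p^-isUnitFraction : ∀ e → IsUnitFraction (p^- e) (p ^ e)
  p^-isUnitFraction e = 1/n-isUnitFraction (p ^ e) {{m^n≢0 p e}}

  p⁻¹≤1 : p⁻¹ ℚ.≤ 1ℚ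
  p⁻¹≤1 = unitFraction-antitone (1/n-isUnitFraction p) (refl , refl) (ℕP.<⇒≤ 1<p)

  dp-nonNeg : ∀ m n → 0ℚ ℚ.≤ dp p m n
  dp-nonNeg m n with m ℕ.≟ n
  ... | yes _ = ℚP.≤-refl
  ... | no  _ = 1/n-nonNeg (p ^ val p ∣ m - n ∣) {{m^n≢0 p (val p ∣ m - n ∣)}}

  dp≤1 : ∀ m n → dp p m n ℚ.≤ 1ℚ
  dp≤1 m n with m ℕ.≟ n
  ... | yes _ = 0≤1
  ... | no  _ = unitFraction-antitone (p^-isUnitFraction (val p ∣ m - n ∣)) (refl , refl)
                  (ℕP.m^n>0 p (val p ∣ m - n ∣))

  dp-indivisible : ∀ m n → ¬ (p ∣ ∣ m - n ∣) → dp p m n ≡ 1ℚ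
  dp-indivisible m n p∤m-n with m ℕ.≟ n
  ... | yes refl = contradiction (subst (p ∣_) (sym (ℕP.∣n-n∣≡0 m)) (p ∣0)) p∤m-n
  ... | no  _ rewrite val-indivisible ∣ m - n ∣ p∤m-n = refl

  -- Key contraction: if p·|a - a'| = |m - m'| then (1/p)·d_p(a,a') ≤ d_p(m,m'),
  -- because v(m - m') ≤ 1 + v(a - a').
  dp-contract : ∀ a a' m m' → p * ∣ a - a' ∣ ≡ ∣ m - m' ∣ → p⁻¹ ℚ.* dp p a a' ℚ.≤ dp p m m'
  dp-contract a a' m m' eq with a ℕ.≟ a'
  ... | yes _ = subst (ℚ._≤ dp p m m') (sym (ℚP.*-zeroʳ p⁻¹)) (dp-nonNeg m m')
  ... | no a≢a' with m ℕ.≟ m'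
  ...   | yes refl = contradiction (ℕP.∣m-n∣≡0⇒m≡n (ℕP.m*n≡0⇒m≡0 _ p
                        (trans (ℕP.*-comm ∣ a - a' ∣ p) (trans eq (ℕP.∣n-n∣≡0 m))))) a≢a'
  ...   | no  _ = unitFraction-antitone
                    (*-isUnitFraction p⁻¹ (p^- val p ∣ a - a' ∣) (1/n-isUnitFraction p) (p^-isUnitFraction (val p ∣ a - a' ∣)))
                    (p^-isUnitFraction (val p ∣ m - m' ∣))
                    (ℕP.^-monoʳ-≤ p (subst (λ k → val p k ℕ.≤ suc (val p ∣ a - a' ∣)) eq
                       (val-p* ∣ a - a' ∣ (ℕP.n≢0⇒n>0 (λ d≡0 → a≢a' (ℕP.∣m-n∣≡0⇒m≡n d≡0))))))

  dV-≡ : ∀ {c c'} → c ≡ c' → dV c c' ≡ 0ℚ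
  dV-≡ {c} {c'} c≡c' with c ℕ.≟ c'
  ... | yes _    = refl
  ... | no  c≢c' = contradiction c≡c' c≢c'

  dV≤1 : ∀ c c' → dV c c' ℚ.≤ 1ℚ
  dV≤1 c c' with c ℕ.≟ c'
  ... | yes _ = 0≤1
  ... | no  _ = ℚP.≤-refl

  dTarget≤1 : ∀ x y → dTarget p x y ℚ.≤ 1ℚ
  dTarget≤1 ((a , b) , c) ((a' , b') , c') = ℚP.⊔-lub scaled≤1 (dV≤1 c c')
    where
    scaled≤1 : p⁻¹ ℚ.* (dp p a a' ⊔ dp p b b') ℚ.≤ 1ℚ
    scaled≤1 = ℚP.≤-trans (ℚP.*-monoˡ-≤-nonNeg p⁻¹ (ℚP.⊔-lub (dp≤1 a a') (dp≤1 b b')))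
                 (subst (ℚ._≤ 1ℚ) (sym (ℚP.*-identityʳ p⁻¹)) p⁻¹≤1)

  dTarget-lub : ∀ (x y : (ℕ × ℕ) × ℕ) D → let ((a , b) , c) = x; ((a' , b') , c') = y in
                p⁻¹ ℚ.* dp p a a' ℚ.≤ D → p⁻¹ ℚ.* dp p b b' ℚ.≤ D → dV c c' ℚ.≤ D →
                dTarget p x y ℚ.≤ D
  dTarget-lub ((a , b) , c) ((a' , b') , c') D ha hb hc =
    ℚP.⊔-lub (subst (ℚ._≤ D) (sym (ℚP.*-distribˡ-⊔-nonNeg p⁻¹ (dp p a a') (dp p b b')))
                    (ℚP.⊔-lub ha hb))
             hc

module Residues (p : ℕ) .{{_ : NonZero p}} where

  ∸-divisible⇒%≡ : ∀ {x y} → x ℕ.≤ y → p ∣ y ∸ x → y % p ≡ x % p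
  ∸-divisible⇒%≡ {x} x≤y p∣y-x = trans (cong (_% p) (sym (ℕP.m+[n∸m]≡n x≤y))) (%-remove-+ʳ x p∣y-x)

  ∣-∣-divisible⇒%≡ : ∀ m n → p ∣ ∣ m - n ∣ → m % p ≡ n % p
  ∣-∣-divisible⇒%≡ m n p∣m-n with ℕP.≤-total m n
  ... | inj₁ m≤n = sym (∸-divisible⇒%≡ m≤n (subst (p ∣_) (ℕP.m≤n⇒∣m-n∣≡n∸m m≤n) p∣m-n))
  ... | inj₂ n≤m = ∸-divisible⇒%≡ n≤m (subst (p ∣_) (trans (ℕP.∣-∣-comm m n) (ℕP.m≤n⇒∣m-n∣≡n∸m n≤m)) p∣m-n)

  quotient-distance : ∀ m m' → m % p ≡ m' % p → p * ∣ m / p - m' / p ∣ ≡ ∣ m - m' ∣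
  quotient-distance m m' same = begin
    p * ∣ m / p - m' / p ∣                                  ≡⟨ ℕP.*-distribˡ-∣-∣ p (m / p) (m' / p) ⟩
    ∣ p * (m / p) - p * (m' / p) ∣                           ≡⟨ cong₂ ∣_-_∣ (ℕP.*-comm p (m / p)) (ℕP.*-comm p (m' / p)) ⟩
    ∣ m / p * p - m' / p * p ∣                               ≡⟨ ℕP.∣m+n-m+o∣≡∣n-o∣ (m % p) (m / p * p) (m' / p * p) ⟨
    ∣ m % p + m / p * p - m % p + m' / p * p ∣               ≡⟨ cong (λ r → ∣ m % p + m / p * p - r + m' / p * p ∣) same ⟩
    ∣ m % p + m / p * p - m' % p + m' / p * p ∣              ≡⟨ cong₂ ∣_-_∣ (m≡m%n+[m/n]*n m p) (m≡m%n+[m/n]*n m' p) ⟨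
    ∣ m - m' ∣                                              ∎
    where open ≡-Reasoning

  quotient+carry-distance : ∀ m m' c → m % p ≡ m' % p → p * ∣ m / p + c - (m' / p + c) ∣ ≡ ∣ m - m' ∣
  quotient+carry-distance m m' c same = begin
    p * ∣ m / p + c - (m' / p + c) ∣   ≡⟨ cong (p *_) (cong₂ ∣_-_∣ (ℕP.+-comm (m / p) c) (ℕP.+-comm (m' / p) c)) ⟩
    p * ∣ c + m / p - (c + m' / p) ∣   ≡⟨ cong (p *_) (ℕP.∣m+n-m+o∣≡∣n-o∣ c (m / p) (m' / p)) ⟩
    p * ∣ m / p - m' / p ∣             ≡⟨ quotient-distance m m' same ⟩
    ∣ m - m' ∣                         ∎
    where open ≡-Reasoning

module Nonexpansion (p : ℕ) .{{_ : NonZero p}} (1<p : 1 < p) where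

  open Metric p 1<p
  open Residues p

  far-inputs : ∀ x y → 1ℚ ℚ.≤ dNN p x y → dTarget p (A p x) (A p y) ℚ.≤ dNN p x y
  far-inputs x y 1≤d = ℚP.≤-trans (dTarget≤1 (A p x) (A p y)) 1≤d

  distinct-residues⇒far : ∀ m m' → m % p ≢ m' % p → 1ℚ ℚ.≤ dp p m m'
  distinct-residues⇒far m m' m≢m' =
    ℚP.≤-reflexive (sym (dp-indivisible m m' (λ p∣ → m≢m' (∣-∣-divisible⇒%≡ m m' p∣))))

  residues-agree : ∀ m n m' n' → m % p ≡ m' % p → n % p ≡ n' % p →
                   dTarget p (A p (m , n)) (A p (m' , n')) ℚ.≤ dNN p (m , n) (m' , n')
  residues-agree m n m' n' m≡ n≡ = dTarget-lub (A p (m , n)) (A p (m' , n')) D first second third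
    where
    D = dp p m m' ⊔ dp p n n'
    carry≡ : (m % p + n % p) / p ≡ (m' % p + n' % p) / p
    carry≡ = cong₂ (λ r s → (r + s) / p) m≡ n≡
    first : p⁻¹ ℚ.* dp p (m / p + (m % p + n % p) / p) (m' / p + (m' % p + n' % p) / p) ℚ.≤ D
    first = ℚP.≤-trans
      (dp-contract (m / p + (m % p + n % p) / p) (m' / p + (m' % p + n' % p) / p) m m' (subst (λ c → p * ∣ m / p + (m % p + n % p) / p - (m' / p + c) ∣ ≡ ∣ m - m' ∣)
                               carry≡ (quotient+carry-distance m m' _ m≡)))
      (ℚP.p≤p⊔q (dp p m m') (dp p n n'))
    second : p⁻¹ ℚ.* dp p (n / p) (n' / p) ℚ.≤ D
    second = ℚP.≤-trans (dp-contract (n / p) (n' / p) n n' (quotient-distance n n' n≡)) (ℚP.p≤q⊔p (dp p m m') (dp p n n'))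
    sum≡ : (m + n) % p ≡ (m' + n') % p
    sum≡ = trans (%-distribˡ-+ m n p) (trans (cong₂ (λ r s → (r + s) % p) m≡ n≡) (sym (%-distribˡ-+ m' n' p)))
    third : dV ((m + n) % p) ((m' + n') % p) ℚ.≤ D
    third = subst (ℚ._≤ D) (sym (dV-≡ sum≡)) (ℚP.≤-trans (dp-nonNeg m m') (ℚP.p≤p⊔q (dp p m m') (dp p n n')))

  A-nonexpanding : Nonexpanding p (A p)
  A-nonexpanding (m , n) (m' , n') with m % p ℕ.≟ m' % p | n % p ℕ.≟ n' % p
  ... | yes m≡ | yes n≡ = residues-agree m n m' n' m≡ n≡
  ... | no  m≢ | _      = far-inputs _ _ (ℚP.≤-trans (distinct-residues⇒far m m' m≢) (ℚP.p≤p⊔q (dp p m m') (dp p n n')))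
  ... | yes _  | no n≢  = far-inputs _ _ (ℚP.≤-trans (distinct-residues⇒far n n' n≢) (ℚP.p≤q⊔p (dp p m m') (dp p n n')))

-- A prime is nontrivial, i.e. p > 1, which is all the argument requires.
mainTheorem1 : (p : ℕ) → .{{_ : NonZero p}} → Prime p → Nonexpanding p (A p)
mainTheorem1 p record { nontrivial = p-nontrivial } =
  Nonexpansion.A-nonexpanding p (ℕ.nonTrivial⇒n>1 p {{p-nontrivial}})
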